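{- There exist absolute constants $c>0$ and $C>0$ such that for every positive integer $N$, every real $K$ with $0<K\le cN$, and every collection $\mathcal S$ of $N$-sets in $[N^2]$ with $|\mathcal S|\le KN$, we have $$C(\mathcal S)\le C\,K.$$ In particular, $C(\mathcal S)=O(1)$ whenever $|\mathcal S|=O(N)$.
   Context: For an integer $M$, $[M]$ denotes a set with $M$ elements. An $N$-set is a subset of $[N^2]$ with exactly $N$ elements. For a collection $\mathcal S$ of $N$-sets in $[N^2]$, the quantity $C(\mathcal S)$ (written without confusion with the constant $C$ by context) is $$C(\mathcal S)=\min_{S'}\max_{S\in\mathcal S}|S\cap S'|,$$ where the minimum is over all $N$-sets $S'$ in $[N^2]$.
   Formalization: The parameter K ranges over the rationals rather than the reals, and the constants c and C are taken in the rationals as well. -}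

module Defs where

open import Data.Nat using (ℕ; zero; suc; _*_; _⊔_; _⊓_)
open import Data.Nat.Properties using (_≟_)
open import Data.List using (List; []; _∷_; map; foldr; filter; _++_)
open import Data.Vec using (_∷_; [])
open import Data.Fin.Subset using (Subset; inside; outside; ∣_∣; _∩_)
open import Relation.Binary.PropositionalEquality using (_≡_)

-- [M] is modelled as Fin M; subsets of [M] as Data.Fin.Subset M.

allSubsets : (n : ℕ) → List (Subset n)
allSubsets zero = [] ∷ []
allSubsets (suc n) =
  map (inside ∷_) (allSubsets n) ++ map (outside ∷_) (allSubsets n)

IsNSet : (N : ℕ) → Subset (N * N) → Set
IsNSet N S = ∣ S ∣ ≡ N

allNSets : (N : ℕ) → List (Subset (N * N))
allNSets N = filter (λ S → ∣ S ∣ ≟ N) (allSubsets (N * N))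

-- max_{S ∈ 𝒮} |S ∩ S'|  (0 for the empty collection)
maxInter : {M : ℕ} → List (Subset M) → Subset M → ℕ
maxInter 𝒮 S' = foldr (λ S m → ∣ S ∩ S' ∣ ⊔ m) 0 (𝒮)

-- minimum of a nonempty list of naturals (0 on the empty list, which never
-- occurs below since N-sets in [N^2] always exist)
minList : List ℕ → ℕ
minList [] = 0
minList (x ∷ xs) = foldr _⊓_ x xs

Cval : (N : ℕ) → List (Subset (N * N)) → ℕ
Cval N 𝒮 = minList (map (maxInter 𝒮) (allNSets N))

-- Let m = |𝒮| and pick D with D N ≤ 4m < (D + 1) N. Call a point heavy if it lies in more
-- than D members of 𝒮; double counting gives fewer than N²/4 heavy points. Build T greedily
-- out of light points while keeping |S ∩ T| ≤ 2D for every S ∈ 𝒮. As long as |T| < N, the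
-- members already meeting T in 2D points are fewer than N/2, because together they meet T in
-- at most D |T| points (for D = 0: there are at most m < N/4 members at all). So the heavy
-- points, T and those saturated members cover fewer than N² points, and any remaining point
-- can be added to T. This yields an N-set T with C(𝒮) ≤ 2D ≤ 8m/N ≤ 8K.

module Submission where

open import Defs

-- ℕ's orders are opened only inside the next two modules, so that _≤_ and _<_ in the theorem
-- statement refer to ℚ.
module Arithmetic where
  open import Data.List.Base using ([]; _∷_)
  open import Data.Nat.Base using (ℕ; zero; suc; _+_; _*_; _≤_; _<_; z≤n; s≤s; NonZero)
  open import Data.Nat.DivMod using (_/_; _%_; m≡m%n+[m/n]*n; m%n<n)
  open import Data.Nat.Properties
  open import Data.Nat.Tactic.RingSolver using (solve)
  open import Relation.Binary.PropositionalEquality using (subst)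

  m<[1+m/n]*n : ∀ m n .{{_ : NonZero n}} → m < suc (m / n) * n
  m<[1+m/n]*n m n = begin-strict
    m                   ≡⟨ m≡m%n+[m/n]*n m n ⟩
    m % n + (m / n) * n <⟨ +-monoˡ-< _ (m%n<n m n) ⟩
    n + (m / n) * n     ∎
    where open ≤-Reasoning

  2*n≤n*n+1 : ∀ n → 2 * n ≤ n * n + 1
  2*n≤n*n+1 zero    = z≤n
  2*n≤n*n+1 (suc n) = ≤-trans (m≤n+m (2 * suc n) (n * n)) (≤-reflexive (solve (n ∷ [])))

  h+[j+f*N]<N*N : ∀ {N} h j f → 4 * h < N * N → j < N → 2 * f < N → h + (j + f * N) < N * N
  h+[j+f*N]<N*N {N} h j f 4h<N*N j<N 2f<N = *-cancelˡ-< 4 _ _ (+-cancelʳ-≤ (2 * N + 4) _ _ (begin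
    suc (4 * (h + (j + f * N))) + (2 * N + 4)           ≡⟨ solve (h ∷ j ∷ f ∷ N ∷ []) ⟩
    suc (4 * h) + (4 * suc j + 2 * (suc (2 * f) * N))   ≤⟨ +-mono-≤ 4h<N*N (+-mono-≤ (*-monoʳ-≤ 4 j<N)
                                                            (*-monoʳ-≤ 2 (*-monoˡ-≤ N 2f<N))) ⟩
    N * N + (4 * N + 2 * (N * N))                       ≡⟨ solve (N ∷ []) ⟩
    3 * (N * N) + 2 * N + 2 * N                         ≤⟨ +-monoʳ-≤ (3 * (N * N) + 2 * N) (2*n≤n*n+1 N) ⟩
    3 * (N * N) + 2 * N + (N * N + 1)                   ≡⟨ solve (N ∷ []) ⟩
    4 * (N * N) + (2 * N + 1)                           ≤⟨ +-monoʳ-≤ (4 * (N * N)) (+-monoʳ-≤ (2 * N) (s≤s z≤n)) ⟩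
    4 * (N * N) + (2 * N + 4)                           ∎))
    where open ≤-Reasoning

  2*f<N : ∀ {N D f j} → f * (2 * D) ≤ j * D → 4 * f < suc D * N → j < N → 2 * f < N
  2*f<N {N} {zero}  {f}     _          4f<N _   =
    ≤-<-trans (*-monoˡ-≤ f (s≤s (s≤s (z≤n {2})))) (subst (4 * f <_) (+-identityʳ N) 4f<N)
  2*f<N {N} {suc D} {f} {j} f*2D≤j*D _    j<N = ≤-<-trans (*-cancelʳ-≤ (2 * f) j (suc D) (begin
    2 * f * suc D   ≡⟨ solve (f ∷ D ∷ []) ⟩
    f * (2 * suc D) ≤⟨ f*2D≤j*D ⟩
    j * suc D       ∎)) j<N
    where open ≤-Reasoning

module Combinatorics where
  open import Data.Bool.Base using (true; false; if_then_else_)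
  open import Data.Bool.Properties using (∧-zeroʳ)
  open import Data.Empty using (⊥-elim)
  open import Data.Fin.Base using (Fin; zero; suc)
  open import Data.Fin.Subset using (Subset; inside; outside; ∣_∣; _∩_; _∪_; ⊥; ⊤; ⁅_⁆; ⋃; _∉_; _⊆_)
  open import Data.Fin.Subset.Properties
    using ( ∣⊥∣≡0; ∣⁅x⁆∣≡1; ∣p∩q∣≤∣q∣; drop-there; p⊆p∪q; q⊆p∪q; x∈p∪q⁺
          ; ∩-comm; ∩-identityʳ; ∩-zeroˡ; ∩-zeroʳ; ∩-distribˡ-∪; ∩-distribʳ-∪; ∪-identityʳ)
  open import Data.List.Base as List using (List; []; _∷_; length; filter; foldr)
  open import Data.List.Membership.Propositional using () renaming (_∈_ to _∈ₗ_)
  open import Data.List.Membership.Propositional.Properties using (∈-map⁺; ∈-++⁺ˡ; ∈-++⁺ʳ; ∈-filter⁺)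
  open import Data.List.Properties using (length-filter)
  open import Data.List.Relation.Unary.All as All using (All; []; _∷_)
  open import Data.List.Relation.Unary.All.Properties using (filter⁺)
  open import Data.List.Relation.Unary.Any using (here; there)
  open import Data.Nat.Base using (ℕ; zero; suc; _+_; _*_; _≤_; _<_; _<ᵇ_; _≤ᵇ_; _⊓_; z≤n; s≤s; NonZero)
  open import Data.Nat.DivMod using (_/_; m/n*n≤m)
  open import Data.Nat.ListAction using (sum)
  open import Data.Nat.Properties
  open import Algebra.Properties.CommutativeSemigroup +-commutativeSemigroup
    using () renaming (interchange to +-interchange)
  open import Data.Product.Base using (∃; _×_; _,_; proj₁; proj₂)
  open import Data.Sum.Base using (inj₁; inj₂)
  open import Data.Vec.Base as Vec using (Vec; []; _∷_; replicate; zipWith; here; there)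
  open import Data.Vec.Properties using (∷-injectiveʳ)
  open import Function.Base using (_∘_; case_of_)
  open import Relation.Binary.PropositionalEquality
  open import Relation.Nullary.Decidable.Core using (yes; no)
  open import Relation.Nullary.Reflects using (ofʸ; ofⁿ)

  open Arithmetic

  private
    variable
      n : ℕ

  ∣p∪q∣+∣p∩q∣≡∣p∣+∣q∣ : ∀ (p q : Subset n) → ∣ p ∪ q ∣ + ∣ p ∩ q ∣ ≡ ∣ p ∣ + ∣ q ∣
  ∣p∪q∣+∣p∩q∣≡∣p∣+∣q∣ []            []            = refl
  ∣p∪q∣+∣p∩q∣≡∣p∣+∣q∣ (inside  ∷ p) (inside  ∷ q) = cong suc (begin
    ∣ p ∪ q ∣ + suc ∣ p ∩ q ∣   ≡⟨ +-suc ∣ p ∪ q ∣ ∣ p ∩ q ∣ ⟩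
    suc (∣ p ∪ q ∣ + ∣ p ∩ q ∣) ≡⟨ cong suc (∣p∪q∣+∣p∩q∣≡∣p∣+∣q∣ p q) ⟩
    suc (∣ p ∣ + ∣ q ∣)         ≡⟨ +-suc ∣ p ∣ ∣ q ∣ ⟨
    ∣ p ∣ + suc ∣ q ∣           ∎)
    where open ≡-Reasoning
  ∣p∪q∣+∣p∩q∣≡∣p∣+∣q∣ (inside  ∷ p) (outside ∷ q) = cong suc (∣p∪q∣+∣p∩q∣≡∣p∣+∣q∣ p q)
  ∣p∪q∣+∣p∩q∣≡∣p∣+∣q∣ (outside ∷ p) (inside  ∷ q) =
    trans (cong suc (∣p∪q∣+∣p∩q∣≡∣p∣+∣q∣ p q)) (sym (+-suc ∣ p ∣ ∣ q ∣))
  ∣p∪q∣+∣p∩q∣≡∣p∣+∣q∣ (outside ∷ p) (outside ∷ q) = ∣p∪q∣+∣p∩q∣≡∣p∣+∣q∣ p q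

  ∣p∪q∣≤∣p∣+∣q∣ : ∀ (p q : Subset n) → ∣ p ∪ q ∣ ≤ ∣ p ∣ + ∣ q ∣
  ∣p∪q∣≤∣p∣+∣q∣ p q = ≤-trans (m≤m+n _ _) (≤-reflexive (∣p∪q∣+∣p∩q∣≡∣p∣+∣q∣ p q))

  ∣p∩[q∪r]∣≤∣p∩q∣+∣p∩r∣ : ∀ (p q r : Subset n) → ∣ p ∩ (q ∪ r) ∣ ≤ ∣ p ∩ q ∣ + ∣ p ∩ r ∣
  ∣p∩[q∪r]∣≤∣p∩q∣+∣p∩r∣ p q r rewrite ∩-distribˡ-∪ p q r = ∣p∪q∣≤∣p∣+∣q∣ (p ∩ q) (p ∩ r)

  x∉p⇒p∩⁅x⁆≡⊥ : ∀ {x : Fin n} {p} → x ∉ p → p ∩ ⁅ x ⁆ ≡ ⊥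
  x∉p⇒p∩⁅x⁆≡⊥ {x = zero}  {outside ∷ p} _   = cong (outside ∷_) (∩-zeroʳ p)
  x∉p⇒p∩⁅x⁆≡⊥ {x = zero}  {inside  ∷ p} x∉p = ⊥-elim (x∉p here)
  x∉p⇒p∩⁅x⁆≡⊥ {x = suc x} {s ∷ p}       x∉p = cong₂ _∷_ (∧-zeroʳ s) (x∉p⇒p∩⁅x⁆≡⊥ (x∉p ∘ there))

  x∉p⇒∣p∩⁅x⁆∣≡0 : ∀ {x : Fin n} {p} → x ∉ p → ∣ p ∩ ⁅ x ⁆ ∣ ≡ 0
  x∉p⇒∣p∩⁅x⁆∣≡0 {n} x∉p = trans (cong ∣_∣ (x∉p⇒p∩⁅x⁆≡⊥ x∉p)) (∣⊥∣≡0 n)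

  x∉p⇒∣p∪⁅x⁆∣≡1+∣p∣ : ∀ {x : Fin n} {p} → x ∉ p → ∣ p ∪ ⁅ x ⁆ ∣ ≡ suc ∣ p ∣
  x∉p⇒∣p∪⁅x⁆∣≡1+∣p∣ {x = x} {p} x∉p = begin
    ∣ p ∪ ⁅ x ⁆ ∣                     ≡⟨ sym (+-identityʳ _) ⟩
    ∣ p ∪ ⁅ x ⁆ ∣ + 0                 ≡⟨ cong (∣ p ∪ ⁅ x ⁆ ∣ +_) (sym (x∉p⇒∣p∩⁅x⁆∣≡0 x∉p)) ⟩
    ∣ p ∪ ⁅ x ⁆ ∣ + ∣ p ∩ ⁅ x ⁆ ∣     ≡⟨ ∣p∪q∣+∣p∩q∣≡∣p∣+∣q∣ p ⁅ x ⁆ ⟩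
    ∣ p ∣ + ∣ ⁅ x ⁆ ∣                 ≡⟨ cong (∣ p ∣ +_) (∣⁅x⁆∣≡1 x) ⟩
    ∣ p ∣ + 1                         ≡⟨ +-comm ∣ p ∣ 1 ⟩
    suc ∣ p ∣                         ∎
    where open ≡-Reasoning

  ∣p∩[q∪⁅x⁆]∣≤t : ∀ {t} (p q : Subset n) {x} → ∣ p ∩ q ∣ ≤ t → (t ≤ ∣ p ∩ q ∣ → x ∉ p) →
                  ∣ p ∩ (q ∪ ⁅ x ⁆) ∣ ≤ t
  ∣p∩[q∪⁅x⁆]∣≤t {t = t} p q {x} ∣p∩q∣≤t saturated⇒x∉p with t ≤? ∣ p ∩ q ∣
  ... | yes saturated = begin
    ∣ p ∩ (q ∪ ⁅ x ⁆) ∣       ≤⟨ ∣p∩[q∪r]∣≤∣p∩q∣+∣p∩r∣ p q ⁅ x ⁆ ⟩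
    ∣ p ∩ q ∣ + ∣ p ∩ ⁅ x ⁆ ∣ ≡⟨ cong (∣ p ∩ q ∣ +_) (x∉p⇒∣p∩⁅x⁆∣≡0 (saturated⇒x∉p saturated)) ⟩
    ∣ p ∩ q ∣ + 0             ≡⟨ +-identityʳ _ ⟩
    ∣ p ∩ q ∣                 ≤⟨ ∣p∩q∣≤t ⟩
    t                         ∎
    where open ≤-Reasoning
  ... | no unsaturated = begin
    ∣ p ∩ (q ∪ ⁅ x ⁆) ∣       ≤⟨ ∣p∩[q∪r]∣≤∣p∩q∣+∣p∩r∣ p q ⁅ x ⁆ ⟩
    ∣ p ∩ q ∣ + ∣ p ∩ ⁅ x ⁆ ∣ ≤⟨ +-monoʳ-≤ ∣ p ∩ q ∣ (∣p∩q∣≤∣q∣ p ⁅ x ⁆) ⟩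
    ∣ p ∩ q ∣ + ∣ ⁅ x ⁆ ∣     ≡⟨ cong (∣ p ∩ q ∣ +_) (∣⁅x⁆∣≡1 x) ⟩
    ∣ p ∩ q ∣ + 1             ≡⟨ +-comm _ 1 ⟩
    suc ∣ p ∩ q ∣             ≤⟨ ≰⇒> unsaturated ⟩
    t                         ∎
    where open ≤-Reasoning

  ∣p∣<n⇒∃∉p : ∀ (p : Subset n) → ∣ p ∣ < n → ∃ λ x → x ∉ p
  ∣p∣<n⇒∃∉p (outside ∷ p) _ = zero , λ ()
  ∣p∣<n⇒∃∉p (inside  ∷ p) (s≤s ∣p∣<n) with x , x∉p ← ∣p∣<n⇒∃∉p p ∣p∣<n = suc x , x∉p ∘ drop-there

  p∈ps⇒p⊆⋃ps : ∀ {p} {ps : List (Subset n)} → p ∈ₗ ps → p ⊆ ⋃ ps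
  p∈ps⇒p⊆⋃ps {ps = q ∷ ps} (here refl) = p⊆p∪q (⋃ ps)
  p∈ps⇒p⊆⋃ps {ps = q ∷ ps} (there p∈ps) = q⊆p∪q q (⋃ ps) ∘ p∈ps⇒p⊆⋃ps p∈ps

  ∣⋃ps∣≤∣ps∣*k : ∀ {k} {ps : List (Subset n)} → All (λ p → ∣ p ∣ ≤ k) ps → ∣ ⋃ ps ∣ ≤ length ps * k
  ∣⋃ps∣≤∣ps∣*k {n} []                   = ≤-reflexive (∣⊥∣≡0 n)
  ∣⋃ps∣≤∣ps∣*k {ps = p ∷ ps} (∣p∣≤k ∷ ∣ps∣≤k) =
    ≤-trans (∣p∪q∣≤∣p∣+∣q∣ p (⋃ ps)) (+-mono-≤ ∣p∣≤k (∣⋃ps∣≤∣ps∣*k ∣ps∣≤k))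

  weight : Subset n → Vec ℕ n → ℕ
  weight []            []      = 0
  weight (inside  ∷ p) (d ∷ w) = d + weight p w
  weight (outside ∷ p) (_ ∷ w) = weight p w

  indicator : Subset n → Vec ℕ n
  indicator = Vec.map (λ b → if b then 1 else 0)

  degrees : List (Subset n) → Vec ℕ n
  degrees []       = replicate _ 0
  degrees (p ∷ ps) = zipWith _+_ (indicator p) (degrees ps)

  heavy : ℕ → Vec ℕ n → Subset n
  heavy D = Vec.map (D <ᵇ_)

  weight-zipWith-+ : ∀ (p : Subset n) v w → weight p (zipWith _+_ v w) ≡ weight p v + weight p w
  weight-zipWith-+ []            []      []      = refl
  weight-zipWith-+ (inside  ∷ p) (a ∷ v) (b ∷ w) =
    trans (cong (a + b +_) (weight-zipWith-+ p v w)) (+-interchange a b (weight p v) (weight p w))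
  weight-zipWith-+ (outside ∷ p) (_ ∷ v) (_ ∷ w) = weight-zipWith-+ p v w

  weight-replicate-0 : ∀ (p : Subset n) → weight p (replicate n 0) ≡ 0
  weight-replicate-0 []            = refl
  weight-replicate-0 (inside  ∷ p) = weight-replicate-0 p
  weight-replicate-0 (outside ∷ p) = weight-replicate-0 p

  weight-indicator : ∀ (p q : Subset n) → weight p (indicator q) ≡ ∣ q ∩ p ∣
  weight-indicator []            []            = refl
  weight-indicator (inside  ∷ p) (inside  ∷ q) = cong suc (weight-indicator p q)
  weight-indicator (inside  ∷ p) (outside ∷ q) = weight-indicator p q
  weight-indicator (outside ∷ p) (inside  ∷ q) = weight-indicator p q
  weight-indicator (outside ∷ p) (outside ∷ q) = weight-indicator p q

  weight-degrees : ∀ (p : Subset n) ps → weight p (degrees ps) ≡ sum (List.map (λ q → ∣ q ∩ p ∣) ps)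
  weight-degrees p []       = weight-replicate-0 p
  weight-degrees p (q ∷ ps) = begin
    weight p (zipWith _+_ (indicator q) (degrees ps))  ≡⟨ weight-zipWith-+ p (indicator q) (degrees ps) ⟩
    weight p (indicator q) + weight p (degrees ps)     ≡⟨ cong₂ _+_ (weight-indicator p q) (weight-degrees p ps) ⟩
    ∣ q ∩ p ∣ + sum (List.map (λ q → ∣ q ∩ p ∣) ps)    ∎
    where open ≡-Reasoning

  ∣heavy∣*[1+D]≤weight⊤ : ∀ D (w : Vec ℕ n) → ∣ heavy D w ∣ * suc D ≤ weight ⊤ w
  ∣heavy∣*[1+D]≤weight⊤ D []      = z≤n
  ∣heavy∣*[1+D]≤weight⊤ D (d ∷ w) with D <ᵇ d | <ᵇ-reflects-< D d
  ... | true  | ofʸ D<d = +-mono-≤ D<d (∣heavy∣*[1+D]≤weight⊤ D w)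
  ... | false | ofⁿ _   = ≤-trans (∣heavy∣*[1+D]≤weight⊤ D w) (m≤n+m _ d)

  weight≤∣p∣*D : ∀ D (w : Vec ℕ n) p → p ∩ heavy D w ≡ ⊥ → weight p w ≤ ∣ p ∣ * D
  weight≤∣p∣*D D []      []            _ = z≤n
  weight≤∣p∣*D D (d ∷ w) (outside ∷ p) disj = weight≤∣p∣*D D w p (∷-injectiveʳ disj)
  weight≤∣p∣*D D (d ∷ w) (inside  ∷ p) disj with D <ᵇ d | <ᵇ-reflects-< D d
  ... | true  | ofʸ _   = case disj of λ ()
  ... | false | ofⁿ D≮d = +-mono-≤ (≮⇒≥ D≮d) (weight≤∣p∣*D D w p (∷-injectiveʳ disj))

  sum-map-≡ : ∀ {a} {A : Set a} {f : A → ℕ} {k} {xs} → All (λ x → f x ≡ k) xs → sum (List.map f xs) ≡ length xs * k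
  sum-map-≡ []             = refl
  sum-map-≡ (fx≡k ∷ fxs≡k) = cong₂ _+_ fx≡k (sum-map-≡ fxs≡k)

  ∣filter[t≤f]∣*t≤sum : ∀ {a} {A : Set a} (f : A → ℕ) t xs →
                               length (filter (λ x → t ≤? f x) xs) * t ≤ sum (List.map f xs)
  ∣filter[t≤f]∣*t≤sum f t []       = z≤n
  ∣filter[t≤f]∣*t≤sum f t (x ∷ xs) with t ≤ᵇ f x | ≤ᵇ-reflects-≤ t (f x)
  ... | true  | ofʸ t≤fx = +-mono-≤ t≤fx (∣filter[t≤f]∣*t≤sum f t xs)
  ... | false | ofⁿ _    = ≤-trans (∣filter[t≤f]∣*t≤sum f t xs) (m≤n+m _ (f x))

  minList-≤ : ∀ {y} xs → y ∈ₗ xs → minList xs ≤ y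
  minList-≤ (x ∷ xs) = foldr-⊓-≤ x xs
    where
    foldr-⊓-≤ : ∀ {y} x xs → y ∈ₗ x ∷ xs → foldr _⊓_ x xs ≤ y
    foldr-⊓-≤ x []       (here refl)          = ≤-refl
    foldr-⊓-≤ x (z ∷ zs) (there (here refl))  = m⊓n≤m z _
    foldr-⊓-≤ x (z ∷ zs) (here refl)          = m≤n⇒o⊓m≤n z (foldr-⊓-≤ x zs (here refl))
    foldr-⊓-≤ x (z ∷ zs) (there (there y∈zs)) = m≤n⇒o⊓m≤n z (foldr-⊓-≤ x zs (there y∈zs))

  maxInter-≤ : ∀ {t} (ps : List (Subset n)) {q} → All (λ p → ∣ p ∩ q ∣ ≤ t) ps → maxInter ps q ≤ t
  maxInter-≤ []       []             = z≤n
  maxInter-≤ (p ∷ ps) (p∩q≤t ∷ ps∩q≤t) = ⊔-lub p∩q≤t (maxInter-≤ ps ps∩q≤t)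

  ∈-allSubsets : ∀ n (p : Subset n) → p ∈ₗ allSubsets n
  ∈-allSubsets zero    []            = here refl
  ∈-allSubsets (suc n) (inside  ∷ p) = ∈-++⁺ˡ (∈-map⁺ (inside ∷_) (∈-allSubsets n p))
  ∈-allSubsets (suc n) (outside ∷ p) =
    ∈-++⁺ʳ (List.map (inside ∷_) (allSubsets n)) (∈-map⁺ (outside ∷_) (∈-allSubsets n p))

  Cval≤maxInter : ∀ N 𝒮 {T} → IsNSet N T → Cval N 𝒮 ≤ maxInter 𝒮 T
  Cval≤maxInter N 𝒮 {T} ∣T∣≡N = minList-≤ (List.map (maxInter 𝒮) (allNSets N))
    (∈-map⁺ (maxInter 𝒮) (∈-filter⁺ (λ S → ∣ S ∣ ≟ N) (∈-allSubsets (N * N) T) ∣T∣≡N))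

  module Greedy {N : ℕ} .{{_ : NonZero N}} (𝒮 : List (Subset (N * N))) (𝒮-NSets : All (IsNSet N) 𝒮)
                (D : ℕ) (4∣𝒮∣<[1+D]*N : 4 * length 𝒮 < suc D * N) where

    H : Subset (N * N)
    H = heavy D (degrees 𝒮)

    record Sparse (T : Subset (N * N)) : Set where
      field
        light  : T ∩ H ≡ ⊥
        sparse : All (λ S → ∣ S ∩ T ∣ ≤ 2 * D) 𝒮

    saturated : Subset (N * N) → List (Subset (N * N))
    saturated T = filter (λ S → 2 * D ≤? ∣ S ∩ T ∣) 𝒮

    4*∣H∣<N*N : 4 * ∣ H ∣ < N * N
    4*∣H∣<N*N = *-cancelʳ-< (suc D) (4 * ∣ H ∣) (N * N) (begin-strict
      4 * ∣ H ∣ * suc D                     ≡⟨ *-assoc 4 ∣ H ∣ (suc D) ⟩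
      4 * (∣ H ∣ * suc D)                   ≤⟨ *-monoʳ-≤ 4 (∣heavy∣*[1+D]≤weight⊤ D (degrees 𝒮)) ⟩
      4 * weight ⊤ (degrees 𝒮)              ≡⟨ cong (4 *_) (weight-degrees ⊤ 𝒮) ⟩
      4 * sum (List.map (λ S → ∣ S ∩ ⊤ ∣) 𝒮) ≡⟨ cong (4 *_) (sum-map-≡ (All.map (λ {S} → ∣S∩⊤∣≡N {S}) 𝒮-NSets)) ⟩
      4 * (length 𝒮 * N)                    ≡⟨ *-assoc 4 (length 𝒮) N ⟨
      4 * length 𝒮 * N                      <⟨ *-monoˡ-< N 4∣𝒮∣<[1+D]*N ⟩
      suc D * N * N                         ≡⟨ *-assoc (suc D) N N ⟩
      suc D * (N * N)                       ≡⟨ *-comm (suc D) (N * N) ⟩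
      N * N * suc D                         ∎)
      where
      open ≤-Reasoning
      ∣S∩⊤∣≡N : ∀ {S} → IsNSet N S → ∣ S ∩ ⊤ ∣ ≡ N
      ∣S∩⊤∣≡N {S} = trans (cong ∣_∣ (∩-identityʳ S))

    2*∣saturated∣<N : ∀ {T} → Sparse T → ∣ T ∣ < N → 2 * length (saturated T) < N
    2*∣saturated∣<N {T} sparseT ∣T∣<N = 2*f<N {f = length (saturated T)} counted
      (≤-<-trans (*-monoʳ-≤ 4 (length-filter (λ S → 2 * D ≤? ∣ S ∩ T ∣) 𝒮)) 4∣𝒮∣<[1+D]*N) ∣T∣<N
      where
      counted : length (saturated T) * (2 * D) ≤ ∣ T ∣ * D
      counted = begin
        length (saturated T) * (2 * D)       ≤⟨ ∣filter[t≤f]∣*t≤sum (λ S → ∣ S ∩ T ∣) (2 * D) 𝒮 ⟩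
        sum (List.map (λ S → ∣ S ∩ T ∣) 𝒮)   ≡⟨ weight-degrees T 𝒮 ⟨
        weight T (degrees 𝒮)                 ≤⟨ weight≤∣p∣*D D (degrees 𝒮) T (Sparse.light sparseT) ⟩
        ∣ T ∣ * D                            ∎
        where open ≤-Reasoning

    extend : ∀ {T} → Sparse T → ∣ T ∣ < N → ∃ λ x → x ∉ T × Sparse (T ∪ ⁅ x ⁆)
    extend {T} sparseT ∣T∣<N = x , x∉T , record { light = light ; sparse = All.tabulate sparse }
      where
      U = ⋃ (saturated T)
      ∣U∣≤∣saturated∣*N : ∣ U ∣ ≤ length (saturated T) * N
      ∣U∣≤∣saturated∣*N = ∣⋃ps∣≤∣ps∣*k (All.map ≤-reflexive (filter⁺ _ 𝒮-NSets))
      ∣H∪[T∪U]∣<N*N : ∣ H ∪ (T ∪ U) ∣ < N * N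
      ∣H∪[T∪U]∣<N*N = begin-strict
        ∣ H ∪ (T ∪ U) ∣                            ≤⟨ ∣p∪q∣≤∣p∣+∣q∣ H (T ∪ U) ⟩
        ∣ H ∣ + ∣ T ∪ U ∣                          ≤⟨ +-monoʳ-≤ ∣ H ∣ (∣p∪q∣≤∣p∣+∣q∣ T U) ⟩
        ∣ H ∣ + (∣ T ∣ + ∣ U ∣)                    ≤⟨ +-monoʳ-≤ ∣ H ∣ (+-monoʳ-≤ ∣ T ∣ ∣U∣≤∣saturated∣*N) ⟩
        ∣ H ∣ + (∣ T ∣ + length (saturated T) * N) <⟨ h+[j+f*N]<N*N ∣ H ∣ ∣ T ∣ (length (saturated T))
                                                       4*∣H∣<N*N ∣T∣<N (2*∣saturated∣<N sparseT ∣T∣<N) ⟩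
        N * N                                      ∎
        where open ≤-Reasoning
      fresh = ∣p∣<n⇒∃∉p (H ∪ (T ∪ U)) ∣H∪[T∪U]∣<N*N
      x = proj₁ fresh
      x∉H : x ∉ H
      x∉H = proj₂ fresh ∘ x∈p∪q⁺ ∘ inj₁
      x∉T : x ∉ T
      x∉T = proj₂ fresh ∘ x∈p∪q⁺ ∘ inj₂ ∘ x∈p∪q⁺ ∘ inj₁
      x∉U : x ∉ U
      x∉U = proj₂ fresh ∘ x∈p∪q⁺ ∘ inj₂ ∘ x∈p∪q⁺ ∘ inj₂
      light : (T ∪ ⁅ x ⁆) ∩ H ≡ ⊥
      light = begin
        (T ∪ ⁅ x ⁆) ∩ H           ≡⟨ ∩-distribʳ-∪ H T ⁅ x ⁆ ⟩
        (T ∩ H) ∪ (⁅ x ⁆ ∩ H)     ≡⟨ cong₂ _∪_ (Sparse.light sparseT) (trans (∩-comm ⁅ x ⁆ H) (x∉p⇒p∩⁅x⁆≡⊥ x∉H)) ⟩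
        ⊥ ∪ ⊥                     ≡⟨ ∪-identityʳ ⊥ ⟩
        ⊥                         ∎
        where open ≡-Reasoning
      sparse : ∀ {S} → S ∈ₗ 𝒮 → ∣ S ∩ (T ∪ ⁅ x ⁆) ∣ ≤ 2 * D
      sparse {S} S∈𝒮 = ∣p∩[q∪⁅x⁆]∣≤t S T (All.lookup (Sparse.sparse sparseT) S∈𝒮)
        (λ saturatedS → x∉U ∘ p∈ps⇒p⊆⋃ps (∈-filter⁺ _ S∈𝒮 saturatedS))

    sparse-of-size : ∀ j → j ≤ N → ∃ λ T → ∣ T ∣ ≡ j × Sparse T
    sparse-of-size zero    _   = ⊥ , ∣⊥∣≡0 (N * N) , record { light = ∩-zeroˡ H ; sparse = All.universal ∣S∩⊥∣≤2D 𝒮 }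
      where
      ∣S∩⊥∣≤2D : ∀ S → ∣ S ∩ ⊥ ∣ ≤ 2 * D
      ∣S∩⊥∣≤2D S = ≤-trans (∣p∩q∣≤∣q∣ S ⊥) (≤-trans (≤-reflexive (∣⊥∣≡0 (N * N))) z≤n)
    sparse-of-size (suc j) j<N =
      let T , ∣T∣≡j , sparseT = sparse-of-size j (<⇒≤ j<N)
          x , x∉T , sparseT∪⁅x⁆ = extend sparseT (subst (_< N) (sym ∣T∣≡j) j<N)
      in T ∪ ⁅ x ⁆ , trans (x∉p⇒∣p∪⁅x⁆∣≡1+∣p∣ x∉T) (cong suc ∣T∣≡j) , sparseT∪⁅x⁆

  Cval*N≤8*∣𝒮∣ : ∀ N .{{_ : NonZero N}} (𝒮 : List (Subset (N * N))) → All (IsNSet N) 𝒮 →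
                 Cval N 𝒮 * N ≤ 8 * length 𝒮
  Cval*N≤8*∣𝒮∣ N 𝒮 𝒮-NSets =
    let T , ∣T∣≡N , sparseT = sparse-of-size N ≤-refl in begin
    Cval N 𝒮 * N      ≤⟨ *-monoˡ-≤ N (≤-trans (Cval≤maxInter N 𝒮 ∣T∣≡N) (maxInter-≤ 𝒮 (Sparse.sparse sparseT))) ⟩
    2 * D * N         ≡⟨ *-assoc 2 D N ⟩
    2 * (D * N)       ≤⟨ *-monoʳ-≤ 2 (m/n*n≤m (4 * m) N) ⟩
    2 * (4 * m)       ≡⟨ *-assoc 2 4 m ⟨
    8 * m             ∎
    where
    open ≤-Reasoning
    m = length 𝒮
    D = 4 * m / N
    open Greedy 𝒮 𝒮-NSets D (m<[1+m/n]*n (4 * m) N)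

open Combinatorics using (Cval*N≤8*∣𝒮∣)

open import Data.Fin.Subset using (Subset)
open import Data.Integer using (+_; +≤+)
import Data.Integer.Properties as ℤ
open import Data.List using (List; length)
open import Data.List.Relation.Unary.All using (All)
open import Data.List.Relation.Unary.Unique.Propositional using (Unique)
open import Data.Nat using (ℕ; _*_; NonZero)
import Data.Nat as ℕ
open import Data.Product using (Σ; _×_; _,_)
open import Data.Rational using (ℚ; 0ℚ; _/_; _<_; _≤_; *≤*; Positive) renaming (_*_ to _*ℚ_)
open import Data.Rational.Literals using (fromℤ)
open import Data.Rational.Properties
  using (normalize-coprime; normalize-nonNeg; *-cancelʳ-≤-pos; *-monoˡ-≤-nonNeg; *-assoc; positive⁻¹; module ≤-Reasoning)
open import Relation.Binary.PropositionalEquality using (_≡_; cong; cong₂; subst; sym; module ≡-Reasoning)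

+n/1≡fromℤ : ∀ n → + n / 1 ≡ fromℤ (+ n)
+n/1≡fromℤ n = normalize-coprime _

+m*n/1≡+m/1*+n/1 : ∀ m n → + (m ℕ.* n) / 1 ≡ (+ m / 1) *ℚ (+ n / 1)
+m*n/1≡+m/1*+n/1 m n = begin
  + (m ℕ.* n) / 1                   ≡⟨ cong (_/ 1) (ℤ.pos-* m n) ⟩
  fromℤ (+ m) *ℚ fromℤ (+ n)        ≡⟨ cong₂ _*ℚ_ (+n/1≡fromℤ m) (+n/1≡fromℤ n) ⟨
  (+ m / 1) *ℚ (+ n / 1)            ∎
  where open ≡-Reasoning

+m/1≤+n/1 : ∀ {m n} → m ℕ.≤ n → + m / 1 ≤ + n / 1
+m/1≤+n/1 {m} {n} m≤n rewrite +n/1≡fromℤ m | +n/1≡fromℤ n = *≤* (ℤ.*-monoʳ-≤-nonNeg (+ 1) (+≤+ m≤n))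

+n/1-positive : ∀ n .{{_ : NonZero n}} → Positive (+ n / 1)
+n/1-positive (ℕ.suc n) = subst Positive (sym (+n/1≡fromℤ (ℕ.suc n))) _

scale-≤ : ∀ a b m N .{{_ : NonZero N}} K → a ℕ.* N ℕ.≤ b ℕ.* m →
          + m / 1 ≤ K *ℚ (+ N / 1) → + a / 1 ≤ (+ b / 1) *ℚ K
scale-≤ a b m N K aN≤bm m≤KN = *-cancelʳ-≤-pos (+ N / 1) {{+n/1-positive N}} (begin
  (+ a / 1) *ℚ (+ N / 1)          ≡⟨ +m*n/1≡+m/1*+n/1 a N ⟨
  + (a ℕ.* N) / 1                 ≤⟨ +m/1≤+n/1 aN≤bm ⟩
  + (b ℕ.* m) / 1                 ≡⟨ +m*n/1≡+m/1*+n/1 b m ⟩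
  (+ b / 1) *ℚ (+ m / 1)          ≤⟨ *-monoˡ-≤-nonNeg (+ b / 1) {{normalize-nonNeg b 1}} m≤KN ⟩
  (+ b / 1) *ℚ (K *ℚ (+ N / 1))   ≡⟨ *-assoc (+ b / 1) K (+ N / 1) ⟨
  (+ b / 1) *ℚ K *ℚ (+ N / 1)     ∎)
  where open ≤-Reasoning

proposition2p6 : Σ ℚ λ c → Σ ℚ λ C → (0ℚ < c) × (0ℚ < C) ×
    ((N : ℕ) → .{{_ : NonZero N}} → (K : ℚ) → 0ℚ < K → K ≤ c *ℚ ((+ N) / 1) →
      (𝒮 : List (Subset (N * N))) → Unique 𝒮 → All (IsNSet N) 𝒮 →
      ((+ length 𝒮) / 1) ≤ K *ℚ ((+ N) / 1) →
      ((+ Cval N 𝒮) / 1) ≤ C *ℚ K)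
-- Cval N 𝒮 * N ≤ 8 |𝒮| holds for every N and 𝒮.
proposition2p6 = + 1 / 1 , + 8 / 1 , positive⁻¹ (+ 1 / 1) , positive⁻¹ (+ 8 / 1) ,
  λ N K _ _ 𝒮 _ 𝒮-NSets ∣𝒮∣≤KN →
    scale-≤ (Cval N 𝒮) 8 (length 𝒮) N K (Cval*N≤8*∣𝒮∣ N 𝒮 𝒮-NSets) ∣𝒮∣≤KN
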